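{- Let $\mathcal{C}\subseteq\mathbb{N}^d$ be a positive integer cone and $S$ a $\mathcal{C}$-semigroup. Then $S$ is $k$-positioned for some $k\in\mathcal{H}(S)$ if and only if $S$ is symmetric and $\operatorname{F}(S)=k$.
   Context: For a finite $A\subseteq\mathbb{N}^d$, the positive integer cone spanned by $A$ is $\mathcal{C}=\{\sum q_ia_i: a_i\in A, q_i\in\mathbb{Q}_{\geq0}\}\cap\mathbb{N}^d$. A $\mathcal{C}$-semigroup is a finitely generated submonoid $S\subseteq\mathcal{C}$ of $(\mathbb{N}^d,+)$ with $\mathcal{C}\setminus S$ finite; $\mathcal{H}(S)=\mathcal{C}\setminus S$. For $k\in\mathcal{C}$, $S$ is $k$-positioned if $k-h\in S$ for all $h\in\mathcal{H}(S)$. A term order is a total order $\preceq$ on $\mathbb{N}^d$ with $0\preceq v$ and $u\preceq v\Rightarrow u+w\preceq v+w$; $\operatorname{F}_\preceq(S)=\max_\preceq\mathcal{H}(S)$. $\operatorname{PF}(S)=\{x\in\mathcal{H}(S): x+(S\setminus\{0\})\subseteq S\}$. $S$ is symmetric if $\operatorname{PF}(S)=\{\operatorname{F}_\preceq(S)\}$ for a term order $\preceq$; in this case $\operatorname{F}_\preceq(S)$ is independent of $\preceq$ and is denoted $\operatorname{F}(S)$. -}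

module Defs where

open import Level using (0ℓ)
open import Data.Nat as ℕ using (ℕ)
open import Data.Integer as ℤ using (ℤ)
open import Data.Rational as ℚ using (ℚ; 0ℚ)
open import Data.Fin using (Fin; zero; suc)
open import Data.List using (List; []; _∷_; length)
open import Data.Vec using (Vec; replicate; zipWith; map)
open import Data.Product using (Σ; _×_; ∃)
open import Relation.Binary.Core using (Rel)
open import Relation.Binary.Structures using (IsTotalOrder)
open import Relation.Binary.PropositionalEquality using (_≡_)
open import Relation.Nullary using (¬_)
open import Function.Bundles using (_⇔_)

ℕ^ : ℕ → Set
ℕ^ d = Vec ℕ d

0v : ∀ {d} → ℕ^ d
0v = replicate _ 0

_+v_ : ∀ {d} → ℕ^ d → ℕ^ d → ℕ^ d
_+v_ = zipWith ℕ._+_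

combℕ : ∀ {d} (G : List (ℕ^ d)) → (Fin (length G) → ℕ) → ℕ^ d
combℕ []      c = 0v
combℕ (g ∷ G) c = map (c zero ℕ.*_) g +v combℕ G (λ i → c (suc i))

toℚv : ∀ {d} → ℕ^ d → Vec ℚ d
toℚv = map (λ n → ℤ.+ n ℚ./ 1)

combℚ : ∀ {d} (A : List (ℕ^ d)) → (Fin (length A) → ℚ) → Vec ℚ d
combℚ []      q = replicate _ 0ℚ
combℚ (a ∷ A) q = zipWith ℚ._+_ (map (q zero ℚ.*_) (toℚv a)) (combℚ A (λ i → q (suc i)))

InCone : ∀ {d} → List (ℕ^ d) → ℕ^ d → Set
InCone A x = Σ (Fin (length A) → ℚ) λ q → (∀ i → 0ℚ ℚ.≤ q i) × (toℚv x ≡ combℚ A q)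

InMonoid : ∀ {d} → List (ℕ^ d) → ℕ^ d → Set
InMonoid G x = Σ (Fin (length G) → ℕ) λ c → x ≡ combℕ G c

-- Gaps  H(S) = C \ S  of S = ⟨G⟩ w.r.t. the cone spanned by A
IsGap : ∀ {d} → List (ℕ^ d) → List (ℕ^ d) → ℕ^ d → Set
IsGap A G x = InCone A x × ¬ InMonoid G x

-- S = ⟨G⟩ is a C-semigroup, C the cone spanned by A:
-- S ⊆ C and C \ S is finite (contained in some finite list).
data _∈L_ {d} (x : ℕ^ d) : List (ℕ^ d) → Set where
  here  : ∀ {xs} → x ∈L (x ∷ xs)
  there : ∀ {y xs} → x ∈L xs → x ∈L (y ∷ xs)

IsCSemigroup : ∀ {d} → List (ℕ^ d) → List (ℕ^ d) → Set
IsCSemigroup A G =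
  (∀ x → InMonoid G x → InCone A x) ×
  ∃ λ (L : List (ℕ^ _)) → ∀ x → IsGap A G x → x ∈L L

-- S is k-positioned:  k - h ∈ S for every gap h  (i.e. ∃ s ∈ S, h + s = k).
-- (k ∈ C is required as in the definition.)
KPositioned : ∀ {d} → List (ℕ^ d) → List (ℕ^ d) → ℕ^ d → Set
KPositioned A G k =
  InCone A k ×
  (∀ h → IsGap A G h → Σ (ℕ^ _) λ s → InMonoid G s × (h +v s ≡ k))

IsTermOrder : ∀ {d} → Rel (ℕ^ d) 0ℓ → Set
IsTermOrder {d} _≼_ =
  IsTotalOrder _≡_ _≼_ ×
  (∀ v → 0v ≼ v) ×
  (∀ u v w → u ≼ v → (u +v w) ≼ (v +v w))

IsFrobenius : ∀ {d} → List (ℕ^ d) → List (ℕ^ d) → Rel (ℕ^ d) 0ℓ → ℕ^ d → Set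
IsFrobenius A G _≼_ f = IsGap A G f × (∀ h → IsGap A G h → h ≼ f)

IsPseudoFrobenius : ∀ {d} → List (ℕ^ d) → List (ℕ^ d) → ℕ^ d → Set
IsPseudoFrobenius A G x =
  IsGap A G x × (∀ s → InMonoid G s → ¬ s ≡ 0v → InMonoid G (x +v s))

-- "S is symmetric and F(S) = f": for some term order ≼, F_≼(S) = f and PF(S) = {f}.
SymmetricWithFrobenius : ∀ {d} → List (ℕ^ d) → List (ℕ^ d) → ℕ^ d → Set₁
SymmetricWithFrobenius {d} A G f =
  Σ (Rel (ℕ^ d) 0ℓ) λ _≼_ →
    IsTermOrder _≼_ × IsFrobenius A G _≼_ f ×
    (∀ x → IsPseudoFrobenius A G x ⇔ (x ≡ f))

{-# OPTIONS --safe #-}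
-- Write x ≤[ G ] y when y − x ∈ S = ⟨G⟩. If every gap is ≤[ G ] k, then k dominates the gaps in
-- every term order (0 ≼ s gives h ≼ h + s), a pseudo-Frobenius x ≤[ G ] k must equal k (otherwise
-- k ∈ x + (S ∖ {0}) ⊆ S), and k is pseudo-Frobenius, since a gap k + s with s ∈ S ∖ {0} would
-- satisfy k + s ≤[ G ] k. Conversely, starting from a gap and adding nonzero generators that keep it
-- a gap must stop, as there are finitely many gaps; it stops at a pseudo-Frobenius element, which
-- is k when PF(S) = {k}. Membership in S is decidable (in x = Σ cᵢ gᵢ each cᵢ with gᵢ ≠ 0 is at
-- most the coordinate sum of x), which makes these case distinctions constructive.
module Submission where

open import Defs
open import Level using (0ℓ)
open import Data.Nat as ℕ using (ℕ; zero; suc; _≤_; _<_; z≤n; s≤s)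
import Data.Nat.Properties as ℕP
import Data.Nat.ListAction as ListAction
open import Data.Nat.Coprimality using (1-coprimeTo) renaming (sym to coprime-sym)
open import Data.Integer as ℤ using ()
import Data.Integer.Properties as ℤP
open import Data.Rational as ℚ using (ℚ; 0ℚ; mkℚ)
import Data.Rational.Properties as ℚP
open import Data.Fin using (Fin; zero; suc)
open import Data.Fin.Properties using (all?; ¬∀⟶∃¬)
open import Data.List as List using (List; []; _∷_; length; lookup)
open import Data.Vec using (Vec; []; _∷_; zipWith; map; sum)
open import Data.Vec.Properties
  using (zipWith-assoc; zipWith-comm; zipWith-identityˡ; zipWith-identityʳ; ∷-injective; ≡-dec)
import Data.Vec.Functional as Coeffs
open import Data.Vec.Relation.Binary.Lex.Strict as Lex using (Lex-≤)
open import Data.Vec.Relation.Binary.Lex.Core using (base; this; next)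
open import Data.Vec.Relation.Binary.Pointwise.Inductive using (Pointwise; Pointwise-≡⇒≡; ≡⇒Pointwise-≡)
open import Data.Product using (Σ; _×_; _,_; proj₁; proj₂)
open import Data.Sum using (_⊎_; inj₁; inj₂)
open import Data.Unit using (tt)
open import Function using (_∘_)
open import Function.Bundles using (_⇔_; mk⇔; Equivalence)
open import Relation.Binary.Core using (Rel)
open import Relation.Binary.Definitions using (DecidableEquality)
open import Relation.Binary.Structures using (IsTotalOrder)
open import Relation.Binary.PropositionalEquality
open import Relation.Nullary using (¬_; Dec; yes; no)
open import Relation.Nullary.Decidable using (_×-dec_; _→-dec_; ¬?; map′)
open import Relation.Nullary.Negation using (contradiction)
open import Algebra.Bundles using (CommutativeMonoid)
open import Algebra.Properties.CommutativeSemigroup ℕP.+-commutativeSemigroup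
  using () renaming (interchange to ℕ-+-interchange)
open import Algebra.Properties.CommutativeSemigroup
  (CommutativeMonoid.commutativeSemigroup ℚP.+-0-commutativeMonoid)
  using () renaming (interchange to ℚ-+-interchange)

module _ {A : Set} {_∙_ : A → A → A} where

  zipWith-interchange : (∀ w x y z → (w ∙ x) ∙ (y ∙ z) ≡ (w ∙ y) ∙ (x ∙ z)) →
    ∀ {n} (w x y z : Vec A n) →
    zipWith _∙_ (zipWith _∙_ w x) (zipWith _∙_ y z) ≡ zipWith _∙_ (zipWith _∙_ w y) (zipWith _∙_ x z)
  zipWith-interchange inter [] [] [] [] = refl
  zipWith-interchange inter (a ∷ w) (b ∷ x) (c ∷ y) (e ∷ z) =
    cong₂ _∷_ (inter a b c e) (zipWith-interchange inter w x y z)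

  map-distrib-zipWith : {f g h : A → A} → (∀ a → h a ≡ f a ∙ g a) →
    ∀ {n} (v : Vec A n) → map h v ≡ zipWith _∙_ (map f v) (map g v)
  map-distrib-zipWith split [] = refl
  map-distrib-zipWith split (a ∷ v) = cong₂ _∷_ (split a) (map-distrib-zipWith split v)

infixr 30 _·_
_·_ : ∀ {d} → ℕ → ℕ^ d → ℕ^ d
m · u = map (m ℕ.*_) u

_∸v_ : ∀ {d} → ℕ^ d → ℕ^ d → ℕ^ d
_∸v_ = zipWith ℕ._∸_

_≟v_ : ∀ {d} → DecidableEquality (ℕ^ d)
_≟v_ = ≡-dec ℕ._≟_

+v-assoc : ∀ {d} (u v w : ℕ^ d) → (u +v v) +v w ≡ u +v (v +v w)
+v-assoc = zipWith-assoc ℕP.+-assoc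

+v-comm : ∀ {d} (u v : ℕ^ d) → u +v v ≡ v +v u
+v-comm = zipWith-comm ℕP.+-comm

+v-identityˡ : ∀ {d} (u : ℕ^ d) → 0v +v u ≡ u
+v-identityˡ = zipWith-identityˡ ℕP.+-identityˡ

+v-identityʳ : ∀ {d} (u : ℕ^ d) → u +v 0v ≡ u
+v-identityʳ = zipWith-identityʳ ℕP.+-identityʳ

+v-interchange : ∀ {d} (w x y z : ℕ^ d) → (w +v x) +v (y +v z) ≡ (w +v y) +v (x +v z)
+v-interchange = zipWith-interchange ℕ-+-interchange

+v-cancelˡ : ∀ {d} (u : ℕ^ d) {v w} → u +v v ≡ u +v w → v ≡ w
+v-cancelˡ [] {[]} {[]} _ = refl
+v-cancelˡ (a ∷ u) {b ∷ v} {c ∷ w} eq with ∷-injective eq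
... | a+b≡a+c , u+v≡u+w = cong₂ _∷_ (ℕP.+-cancelˡ-≡ a b c a+b≡a+c) (+v-cancelˡ u u+v≡u+w)

u+v≡0⇒u≡0 : ∀ {d} (u : ℕ^ d) {v} → u +v v ≡ 0v → u ≡ 0v
u+v≡0⇒u≡0 [] _ = refl
u+v≡0⇒u≡0 (a ∷ u) {b ∷ v} eq with ∷-injective eq
... | a+b≡0 , u+v≡0 = cong₂ _∷_ (ℕP.m+n≡0⇒m≡0 a a+b≡0) (u+v≡0⇒u≡0 u u+v≡0)

u+v+w≡u⇒v≡0 : ∀ {d} (u v w : ℕ^ d) → (u +v v) +v w ≡ u → v ≡ 0v
u+v+w≡u⇒v≡0 u v w eq = u+v≡0⇒u≡0 v (+v-cancelˡ u (begin
  u +v (v +v w) ≡⟨ +v-assoc u v w ⟨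
  (u +v v) +v w ≡⟨ eq ⟩
  u             ≡⟨ +v-identityʳ u ⟨
  u +v 0v       ∎))
  where open ≡-Reasoning

u+v∸u≡v : ∀ {d} (u v : ℕ^ d) → (u +v v) ∸v u ≡ v
u+v∸u≡v [] [] = refl
u+v∸u≡v (a ∷ u) (b ∷ v) = cong₂ _∷_ (ℕP.m+n∸m≡n a b) (u+v∸u≡v u v)

·-distribʳ : ∀ {d} m n (u : ℕ^ d) → (m ℕ.+ n) · u ≡ m · u +v n · u
·-distribʳ m n u = map-distrib-zipWith {_∙_ = ℕ._+_} (λ a → ℕP.*-distribʳ-+ a m n) u

·-identityˡ : ∀ {d} (u : ℕ^ d) → 1 · u ≡ u
·-identityˡ [] = refl
·-identityˡ (a ∷ u) = cong₂ _∷_ (ℕP.*-identityˡ a) (·-identityˡ u)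

·-suc : ∀ {d} m (u : ℕ^ d) → suc m · u ≡ u +v m · u
·-suc m [] = refl
·-suc m (a ∷ u) = cong (a ℕ.+ m ℕ.* a ∷_) (·-suc m u)

·-zeroˡ : ∀ {d} (u : ℕ^ d) → 0 · u ≡ 0v
·-zeroˡ [] = refl
·-zeroˡ (a ∷ u) = cong (0 ∷_) (·-zeroˡ u)

·-zeroʳ : ∀ {d} m → m · 0v {d} ≡ 0v
·-zeroʳ {zero} m = refl
·-zeroʳ {suc d} m = cong₂ _∷_ (ℕP.*-zeroʳ m) (·-zeroʳ m)

sum-+v : ∀ {d} (u v : ℕ^ d) → sum (u +v v) ≡ sum u ℕ.+ sum v
sum-+v [] [] = refl
sum-+v (a ∷ u) (b ∷ v) = trans (cong (a ℕ.+ b ℕ.+_) (sum-+v u v)) (ℕ-+-interchange a b (sum u) (sum v))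

sum-· : ∀ {d} m (u : ℕ^ d) → sum (m · u) ≡ m ℕ.* sum u
sum-· m [] = sym (ℕP.*-zeroʳ m)
sum-· m (a ∷ u) = trans (cong (m ℕ.* a ℕ.+_) (sum-· m u)) (sym (ℕP.*-distribˡ-+ m a (sum u)))

u≢0⇒0<sum : ∀ {d} {u : ℕ^ d} → ¬ u ≡ 0v → 0 < sum u
u≢0⇒0<sum {u = []} u≢0 = contradiction refl u≢0
u≢0⇒0<sum {u = zero ∷ u} u≢0 = u≢0⇒0<sum (λ u≡0 → u≢0 (cong (0 ∷_) u≡0))
u≢0⇒0<sum {u = suc a ∷ u} _ = s≤s z≤n

sum<sum[u+v] : ∀ {d} (u : ℕ^ d) {v} → ¬ v ≡ 0v → sum u < sum (u +v v)
sum<sum[u+v] u {v} v≢0 = subst (sum u <_) (sym (sum-+v u v)) (ℕP.m<m+n (sum u) (u≢0⇒0<sum v≢0))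

m≤sum[m·u+v] : ∀ {d} m {u : ℕ^ d} v → ¬ u ≡ 0v → m ≤ sum (m · u +v v)
m≤sum[m·u+v] m {u} v u≢0 = begin
  m                       ≡⟨ ℕP.*-identityʳ m ⟨
  m ℕ.* 1                 ≤⟨ ℕP.*-monoʳ-≤ m (u≢0⇒0<sum u≢0) ⟩
  m ℕ.* sum u             ≡⟨ sum-· m u ⟨
  sum (m · u)             ≤⟨ ℕP.m≤m+n _ _ ⟩
  sum (m · u) ℕ.+ sum v   ≡⟨ sum-+v (m · u) v ⟨
  sum (m · u +v v)        ∎
  where open ℕP.≤-Reasoning

n/1≡mkℚ : ∀ n → ℤ.+ n ℚ./ 1 ≡ mkℚ (ℤ.+ n) 0 (coprime-sym (1-coprimeTo n))
n/1≡mkℚ n = ℚP.normalize-coprime (coprime-sym (1-coprimeTo n))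

n/1-homo-+ : ∀ m n → ℤ.+ (m ℕ.+ n) ℚ./ 1 ≡ ℤ.+ m ℚ./ 1 ℚ.+ ℤ.+ n ℚ./ 1
n/1-homo-+ m n
  rewrite n/1≡mkℚ m | n/1≡mkℚ n | ℕP.*-identityʳ m | ℕP.*-identityʳ n
        | ℤP.+◃n≡+n m | ℤP.+◃n≡+n n = refl

toℚv-homo-+v : ∀ {d} (u v : ℕ^ d) → toℚv (u +v v) ≡ zipWith ℚ._+_ (toℚv u) (toℚv v)
toℚv-homo-+v [] [] = refl
toℚv-homo-+v (a ∷ u) (b ∷ v) = cong₂ _∷_ (n/1-homo-+ a b) (toℚv-homo-+v u v)

combℚ-homo-+ : ∀ {d} (A : List (ℕ^ d)) (q r : Fin (length A) → ℚ) →
  combℚ A (λ i → q i ℚ.+ r i) ≡ zipWith ℚ._+_ (combℚ A q) (combℚ A r)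
combℚ-homo-+ [] q r = sym (zipWith-identityˡ ℚP.+-identityˡ _)
combℚ-homo-+ (a ∷ A) q r = begin
  zipWith ℚ._+_ (map ((q zero ℚ.+ r zero) ℚ.*_) (toℚv a)) (combℚ A (λ i → q (suc i) ℚ.+ r (suc i)))
    ≡⟨ cong₂ (zipWith ℚ._+_)
         (map-distrib-zipWith (λ x → ℚP.*-distribʳ-+ x (q zero) (r zero)) (toℚv a))
         (combℚ-homo-+ A (Coeffs.tail q) (Coeffs.tail r)) ⟩
  zipWith ℚ._+_ (zipWith ℚ._+_ (map (q zero ℚ.*_) (toℚv a)) (map (r zero ℚ.*_) (toℚv a)))
                (zipWith ℚ._+_ (combℚ A (Coeffs.tail q)) (combℚ A (Coeffs.tail r)))
    ≡⟨ zipWith-interchange ℚ-+-interchange _ _ _ _ ⟩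
  zipWith ℚ._+_ (combℚ (a ∷ A) q) (combℚ (a ∷ A) r) ∎
  where open ≡-Reasoning

InCone-+v : ∀ {d} (A : List (ℕ^ d)) {u v} → InCone A u → InCone A v → InCone A (u +v v)
InCone-+v A {u} {v} (q , q≥0 , u≡) (r , r≥0 , v≡) =
  (λ i → q i ℚ.+ r i) ,
  (λ i → subst (ℚ._≤ q i ℚ.+ r i) (ℚP.+-identityˡ 0ℚ) (ℚP.+-mono-≤ (q≥0 i) (r≥0 i))) ,
  (begin
    toℚv (u +v v)                                  ≡⟨ toℚv-homo-+v u v ⟩
    zipWith ℚ._+_ (toℚv u) (toℚv v)                ≡⟨ cong₂ (zipWith ℚ._+_) u≡ v≡ ⟩
    zipWith ℚ._+_ (combℚ A q) (combℚ A r)          ≡⟨ combℚ-homo-+ A q r ⟨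
    combℚ A (λ i → q i ℚ.+ r i)                    ∎)
  where open ≡-Reasoning

combℕ-zero : ∀ {d} (G : List (ℕ^ d)) → combℕ G (λ _ → 0) ≡ 0v
combℕ-zero [] = refl
combℕ-zero (g ∷ G) = trans (cong₂ _+v_ (·-zeroˡ g) (combℕ-zero G)) (+v-identityˡ 0v)

combℕ-homo-+ : ∀ {d} (G : List (ℕ^ d)) (c c′ : Fin (length G) → ℕ) →
  combℕ G (λ i → c i ℕ.+ c′ i) ≡ combℕ G c +v combℕ G c′
combℕ-homo-+ [] c c′ = sym (+v-identityˡ 0v)
combℕ-homo-+ (g ∷ G) c c′ = begin
  (c zero ℕ.+ c′ zero) · g +v combℕ G (λ i → c (suc i) ℕ.+ c′ (suc i))
    ≡⟨ cong₂ _+v_ (·-distribʳ (c zero) (c′ zero) g)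
                  (combℕ-homo-+ G (Coeffs.tail c) (Coeffs.tail c′)) ⟩
  (c zero · g +v c′ zero · g) +v (combℕ G (Coeffs.tail c) +v combℕ G (Coeffs.tail c′))
    ≡⟨ +v-interchange _ _ _ _ ⟩
  combℕ (g ∷ G) c +v combℕ (g ∷ G) c′ ∎
  where open ≡-Reasoning

InMonoid-0v : ∀ {d} (G : List (ℕ^ d)) → InMonoid G 0v
InMonoid-0v G = (λ _ → 0) , sym (combℕ-zero G)

InMonoid-+v : ∀ {d} (G : List (ℕ^ d)) {u v} → InMonoid G u → InMonoid G v → InMonoid G (u +v v)
InMonoid-+v G (c , refl) (c′ , refl) = (λ i → c i ℕ.+ c′ i) , sym (combℕ-homo-+ G c c′)

InMonoid-∷ : ∀ {d} g (G : List (ℕ^ d)) {u} → InMonoid G u → InMonoid (g ∷ G) u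
InMonoid-∷ g G (c , refl) = 0 Coeffs.∷ c , sym (trans (cong (_+v _) (·-zeroˡ g)) (+v-identityˡ _))

InMonoid-lookup : ∀ {d} (G : List (ℕ^ d)) i → InMonoid G (lookup G i)
InMonoid-lookup (g ∷ G) zero =
  1 Coeffs.∷ (λ _ → 0) , sym (trans (cong₂ _+v_ (·-identityˡ g) (combℕ-zero G)) (+v-identityʳ g))
InMonoid-lookup (g ∷ G) (suc i) = InMonoid-∷ g G (InMonoid-lookup G i)

infix 4 _≤[_]_
_≤[_]_ : ∀ {d} → ℕ^ d → List (ℕ^ d) → ℕ^ d → Set
x ≤[ G ] y = Σ (ℕ^ _) λ s → InMonoid G s × x +v s ≡ y

module _ {d} (G : List (ℕ^ d)) where

  ≤[]-refl : ∀ {x} → x ≤[ G ] x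
  ≤[]-refl {x} = 0v , InMonoid-0v G , +v-identityʳ x

  ≤[]-trans : ∀ {x y z} → x ≤[ G ] y → y ≤[ G ] z → x ≤[ G ] z
  ≤[]-trans {x} (s , s∈S , refl) (t , t∈S , refl) = s +v t , InMonoid-+v G s∈S t∈S , sym (+v-assoc x s t)

  ≤[]-step : ∀ x i → x ≤[ G ] x +v lookup G i
  ≤[]-step x i = lookup G i , InMonoid-lookup G i , refl

≤[]-∷ : ∀ {d} g (G : List (ℕ^ d)) {x y} → x ≤[ G ] y → x ≤[ g ∷ G ] y
≤[]-∷ g G (s , s∈S , eq) = s , InMonoid-∷ g G s∈S , eq

AboveNonzeroGenerator : ∀ {d} → List (ℕ^ d) → ℕ^ d → Set
AboveNonzeroGenerator G s = Σ (Fin (length G)) λ i → ¬ lookup G i ≡ 0v × lookup G i ≤[ G ] s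

nonzero⇒aboveNonzeroGenerator : ∀ {d} (G : List (ℕ^ d)) {s} → InMonoid G s → ¬ s ≡ 0v →
  AboveNonzeroGenerator G s
nonzero⇒aboveNonzeroGenerator [] (c , refl) s≢0 = contradiction refl s≢0
nonzero⇒aboveNonzeroGenerator (g ∷ G) (c , refl) = split (c zero) (Coeffs.tail c) (g ≟v 0v)
  where
  fromRest : ∀ m c′ → m · g ≡ 0v → ¬ m · g +v combℕ G c′ ≡ 0v →
    AboveNonzeroGenerator (g ∷ G) (m · g +v combℕ G c′)
  fromRest m c′ m·g≡0 s≢0 with nonzero⇒aboveNonzeroGenerator G (c′ , refl) (s≢0 ∘ s≡r)
    where
    s≡r : combℕ G c′ ≡ 0v → m · g +v combℕ G c′ ≡ 0v
    s≡r r≡0 = trans (cong₂ _+v_ m·g≡0 r≡0) (+v-identityˡ 0v)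
  ... | i , gᵢ≢0 , gᵢ≤r = suc i , gᵢ≢0 , ≤[]-∷ g G (subst (lookup G i ≤[ G ]_) r≡s gᵢ≤r)
    where
    r≡s : combℕ G c′ ≡ m · g +v combℕ G c′
    r≡s = trans (sym (+v-identityˡ _)) (cong (_+v _) (sym m·g≡0))
  split : ∀ m c′ → Dec (g ≡ 0v) → ¬ m · g +v combℕ G c′ ≡ 0v →
    AboveNonzeroGenerator (g ∷ G) (m · g +v combℕ G c′)
  split m c′ (yes refl) = fromRest m c′ (·-zeroʳ m)
  split zero c′ (no _) = fromRest 0 c′ (·-zeroˡ g)
  split (suc m) c′ (no g≢0) _ =
    zero , g≢0 , m · g +v combℕ G c′ , (m Coeffs.∷ c′ , refl) ,
    trans (sym (+v-assoc g (m · g) _)) (cong (_+v _) (sym (·-suc m g)))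

InMonoid? : ∀ {d} (G : List (ℕ^ d)) x → Dec (InMonoid G x)
InMonoid? [] x = map′ ((λ ()) ,_) proj₂ (x ≟v 0v)
InMonoid? (g ∷ G) x with g ≟v 0v
... | yes refl = map′ (InMonoid-∷ 0v G) dropZero (InMonoid? G x)
  where
  dropZero : InMonoid (0v ∷ G) x → InMonoid G x
  dropZero (c , x≡) = Coeffs.tail c ,
    trans x≡ (trans (cong (_+v combℕ G (Coeffs.tail c)) (·-zeroʳ (c zero))) (+v-identityˡ _))
... | no g≢0 = map′ fromMultiple toMultiple (ℕP.anyUpTo? Multiple? (suc (sum x)))
  where
  -- Given the coefficient m of g, the rest can only be x ∸v m · g.
  Multiple : ℕ → Set
  Multiple m = m · g +v (x ∸v m · g) ≡ x × InMonoid G (x ∸v m · g)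
  Multiple? : ∀ m → Dec (Multiple m)
  Multiple? m = (_ ≟v x) ×-dec InMonoid? G (x ∸v m · g)
  fromMultiple : Σ ℕ (λ m → m < suc (sum x) × Multiple m) → InMonoid (g ∷ G) x
  fromMultiple (m , _ , x≡ , c′ , rest≡) = m Coeffs.∷ c′ , trans (sym x≡) (cong (m · g +v_) rest≡)
  toMultiple : InMonoid (g ∷ G) x → Σ ℕ (λ m → m < suc (sum x) × Multiple m)
  toMultiple (c , refl) =
    c zero , s≤s (m≤sum[m·u+v] (c zero) _ g≢0) , cong (c zero · g +v_) rest≡ , (Coeffs.tail c , rest≡)
    where
    rest≡ : (c zero · g +v combℕ G (Coeffs.tail c)) ∸v c zero · g ≡ combℕ G (Coeffs.tail c)
    rest≡ = u+v∸u≡v (c zero · g) _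

_≤lex_ : ∀ {d} → Rel (ℕ^ d) 0ℓ
u ≤lex v = Lex-≤ _≡_ ℕ._<_ u v

≤lex-isTotalOrder : ∀ {d} → IsTotalOrder _≡_ (_≤lex_ {d})
≤lex-isTotalOrder {d} = record
  { isPartialOrder = record
    { isPreorder = record
      { isEquivalence = isEquivalence
      ; reflexive = λ u≡v → Lex.≤-refl (≡⇒Pointwise-≡ u≡v)
      ; trans = IsTotalOrder.trans pointwise
      }
    ; antisym = λ u≤v v≤u → Pointwise-≡⇒≡ (IsTotalOrder.antisym pointwise u≤v v≤u)
    }
  ; total = IsTotalOrder.total pointwise
  }
  where
  pointwise : IsTotalOrder (Pointwise _≡_) (_≤lex_ {d})
  pointwise = Lex.≤-isTotalOrder ℕP.<-isStrictTotalOrder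

0v≤lex : ∀ {d} (v : ℕ^ d) → 0v ≤lex v
0v≤lex [] = base tt
0v≤lex (zero ∷ v) = next refl (0v≤lex v)
0v≤lex (suc a ∷ v) = this (s≤s z≤n) refl

≤lex-+v-monoˡ : ∀ {d} {u v : ℕ^ d} w → u ≤lex v → (u +v w) ≤lex (v +v w)
≤lex-+v-monoˡ [] (base tt) = base tt
≤lex-+v-monoˡ (c ∷ w) (this a<b refl) = this (ℕP.+-monoˡ-< c a<b) refl
≤lex-+v-monoˡ (c ∷ w) (next refl u≤v) = next refl (≤lex-+v-monoˡ w u≤v)

≤lex-isTermOrder : ∀ {d} → IsTermOrder (_≤lex_ {d})
≤lex-isTermOrder = ≤lex-isTotalOrder , 0v≤lex , λ u v w → ≤lex-+v-monoˡ w

≤[]⇒≼ : ∀ {d} {_≼_ : Rel (ℕ^ d) 0ℓ} → IsTermOrder _≼_ → ∀ G {x y} → x ≤[ G ] y → x ≼ y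
≤[]⇒≼ {_≼_ = _≼_} (_ , 0≼ , ≼-+-monoˡ) G {x} (s , _ , refl) =
  subst₂ _≼_ (+v-identityˡ x) (+v-comm s x) (≼-+-monoˡ 0v s x (0≼ s))

pseudoFrobenius-byGenerators : ∀ {d} (A G : List (ℕ^ d)) {x} → IsGap A G x →
  (∀ i → ¬ lookup G i ≡ 0v → InMonoid G (x +v lookup G i)) → IsPseudoFrobenius A G x
pseudoFrobenius-byGenerators A G {x} x-gap x+gᵢ∈S = x-gap , x+s∈S
  where
  x+s∈S : ∀ s → InMonoid G s → ¬ s ≡ 0v → InMonoid G (x +v s)
  x+s∈S s s∈S s≢0 with nonzero⇒aboveNonzeroGenerator G s∈S s≢0
  ... | i , gᵢ≢0 , t , t∈S , refl =
    subst (InMonoid G) (+v-assoc x (lookup G i) t) (InMonoid-+v G (x+gᵢ∈S i gᵢ≢0) t∈S)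

pseudoFrobenius-or-escape : ∀ {d} (A G : List (ℕ^ d)) {x} → IsGap A G x →
  IsPseudoFrobenius A G x ⊎ Σ (Fin (length G)) λ i → ¬ lookup G i ≡ 0v × ¬ InMonoid G (x +v lookup G i)
pseudoFrobenius-or-escape A G {x} x-gap = decide (all? Closed?)
  where
  Closed : Fin (length G) → Set
  Closed i = ¬ lookup G i ≡ 0v → InMonoid G (x +v lookup G i)
  Closed? : ∀ i → Dec (Closed i)
  Closed? i = ¬? (lookup G i ≟v 0v) →-dec InMonoid? G (x +v lookup G i)
  decide : Dec (∀ i → Closed i) →
    IsPseudoFrobenius A G x ⊎ Σ (Fin (length G)) λ i → ¬ lookup G i ≡ 0v × ¬ InMonoid G (x +v lookup G i)
  decide (yes closed) = inj₁ (pseudoFrobenius-byGenerators A G x-gap closed)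
  decide (no ¬closed) with ¬∀⟶∃¬ (length G) Closed Closed? ¬closed
  ... | i , ¬closedᵢ =
    inj₂ (i , (λ gᵢ≡0 → ¬closedᵢ (contradiction gᵢ≡0)) , (λ x+gᵢ∈S → ¬closedᵢ (λ _ → x+gᵢ∈S)))

sizeBound : ∀ {d} → List (ℕ^ d) → ℕ
sizeBound L = ListAction.sum (List.map sum L)

∈L⇒sum≤sizeBound : ∀ {d} {x : ℕ^ d} {L} → x ∈L L → sum x ≤ sizeBound L
∈L⇒sum≤sizeBound here = ℕP.m≤m+n _ _
∈L⇒sum≤sizeBound {L = y ∷ _} (there x∈L) =
  ℕP.≤-trans (∈L⇒sum≤sizeBound x∈L) (ℕP.m≤n+m _ (sum y))

gap≤[]pseudoFrobenius : ∀ {d} (A G : List (ℕ^ d)) → IsCSemigroup A G → ∀ {h} → IsGap A G h →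
  Σ (ℕ^ d) λ f → IsPseudoFrobenius A G f × h ≤[ G ] f
gap≤[]pseudoFrobenius {d} A G (S⊆C , L , gaps∈L) {h} h-gap =
  climb (suc B) h-gap (ℕP.≤-trans (ℕP.n<1+n B) (ℕP.m≤m+n _ (sum h)))
  where
  B : ℕ
  B = sizeBound L
  -- n is fuel: a gap has size at most B, and every step strictly increases the size.
  climb : ∀ n {x} → IsGap A G x → B < n ℕ.+ sum x →
    Σ (ℕ^ d) λ f → IsPseudoFrobenius A G f × x ≤[ G ] f
  climb zero {x} x-gap B<x = contradiction (∈L⇒sum≤sizeBound (gaps∈L x x-gap)) (ℕP.<⇒≱ B<x)
  climb (suc n) {x} x-gap B<x with pseudoFrobenius-or-escape A G x-gap
  ... | inj₁ x-PF = x , x-PF , ≤[]-refl G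
  ... | inj₂ (i , gᵢ≢0 , x+gᵢ∉S)
    with climb n x+gᵢ-gap (ℕP.<-≤-trans B<x (ℕP.+-monoʳ-< n (sum<sum[u+v] x gᵢ≢0)))
    where
    x+gᵢ-gap : IsGap A G (x +v lookup G i)
    x+gᵢ-gap = InCone-+v A (proj₁ x-gap) (S⊆C _ (InMonoid-lookup G i)) , x+gᵢ∉S
  ...   | f , f-PF , x+gᵢ≤f = f , f-PF , ≤[]-trans G (≤[]-step G x i) x+gᵢ≤f

module _ {d} (A G : List (ℕ^ d)) {k}
         (k∉S : ¬ InMonoid G k) (k-pos : ∀ h → IsGap A G h → h ≤[ G ] k) where

  positioned⇒pseudoFrobenius≡k : ∀ {x} → IsPseudoFrobenius A G x → x ≡ k
  positioned⇒pseudoFrobenius≡k {x} (x-gap , x+S⊆S) with k-pos x x-gap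
  ... | s , s∈S , x+s≡k with s ≟v 0v
  ...   | yes refl = trans (sym (+v-identityʳ x)) x+s≡k
  ...   | no s≢0 = contradiction (subst (InMonoid G) x+s≡k (x+S⊆S s s∈S s≢0)) k∉S

  positioned⇒pseudoFrobenius : (∀ x → InMonoid G x → InCone A x) → InCone A k →
    IsPseudoFrobenius A G k
  positioned⇒pseudoFrobenius S⊆C k∈C = (k∈C , k∉S) , k+s∈S
    where
    k+s∈S : ∀ s → InMonoid G s → ¬ s ≡ 0v → InMonoid G (k +v s)
    k+s∈S s s∈S s≢0 with InMonoid? G (k +v s)
    ... | yes k+s∈S = k+s∈S
    ... | no k+s∉S with k-pos (k +v s) (InCone-+v A k∈C (S⊆C s s∈S) , k+s∉S)
    ...   | t , _ , k+s+t≡k = contradiction (u+v+w≡u⇒v≡0 k s t k+s+t≡k) s≢0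

proposition2p2 : (d : ℕ) (A G : List (ℕ^ d)) → IsCSemigroup A G →
    (k : ℕ^ d) → IsGap A G k →
    (KPositioned A G k ⇔ SymmetricWithFrobenius A G k)
proposition2p2 d A G isCS@(S⊆C , _) k k-gap@(k∈C , k∉S) = mk⇔ forward backward
  where
  forward : KPositioned A G k → SymmetricWithFrobenius A G k
  forward (_ , k-pos) =
    _≤lex_ , ≤lex-isTermOrder ,
    (k-gap , λ h h-gap → ≤[]⇒≼ ≤lex-isTermOrder G (k-pos h h-gap)) ,
    λ x → mk⇔ (positioned⇒pseudoFrobenius≡k A G k∉S k-pos)
              (λ { refl → positioned⇒pseudoFrobenius A G k∉S k-pos S⊆C k∈C })
  backward : SymmetricWithFrobenius A G k → KPositioned A G k
  backward (_ , _ , _ , PF⇔≡k) = k∈C , λ h h-gap →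
    let f , f-PF , h≤f = gap≤[]pseudoFrobenius A G isCS h-gap
    in subst (h ≤[ G ]_) (Equivalence.to (PF⇔≡k f) f-PF) h≤f
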